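{- Let $K$ be a commutative semiring, let $\mathcal G=(V,V_0,V_1,T,E)$ be a finite acyclic game graph, let $\sigma\in\{0,1\}$, and let $f_\sigma:V\to K$ be the $K$-valuation for Player $\sigma$ induced by basic valuations $f_\sigma:T\to K$ of the terminal positions and $h_\sigma:E\to K\setminus\{0\}$ of the moves. Then for every position $v\in V$, \[f_\sigma(v)=\sum_{\mathcal S\in\mathrm{Strat}_\sigma(v)}F(\mathcal S).\]
   Context: A game graph is $\mathcal G=(V,V_0,V_1,T,E)$ where $V$ is the disjoint union of $V_0$ (positions of Player 0), $V_1$ (positions of Player 1) and $T$ (terminal positions), $E\subseteq V\times V$, $vE=\{w:(v,w)\in E\}$, and $vE=\emptyset$ iff $v\in T$. The $K$-valuation $f_\sigma:V\to K$ extends the given $f_\sigma$ on $T$ by backward induction: $f_\sigma(v)=\sum_{w\in vE}h_\sigma(vw)\cdot f_\sigma(w)$ if $v\in V_\sigma$ and $f_\sigma(v)=\prod_{w\in vE}h_\sigma(vw)\cdot f_\sigma(w)$ if $v\in V_{1-\sigma}$. The tree unraveling $\mathcal T(\mathcal G,v_0)$ has as nodes all finite paths from $v_0$ and edges $(\pi v,\pi vv')$ for $(v,v')\in E$; a node $\pi v$ belongs to Player $\sigma$ (resp. is terminal) iff $v\in V_\sigma$ (resp. $v\in T$); $\rho$ maps $\pi v$ to $v$ and tree edges to the corresponding edges of $E$. A strategy of Player $\sigma$ from $v_0$ is a subtree $\mathcal S=(W,F)$ of $\mathcal T(\mathcal G,v_0)$ containing the root, with $W$ closed under prefixes, such that each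 node $\pi v\in W$ with $v\in V_\sigma$ has exactly one $F$-successor and each node $\pi v\in W$ with $v\in V_{1-\sigma}$ has all its tree successors as $F$-successors; $\mathrm{Strat}_\sigma(v_0)$ is the set of these. $\#_{\mathcal S}(v)$ (resp. $\#_{\mathcal S}(e)$) is the number of nodes (resp. edges) of $\mathcal S$ mapped by $\rho$ to the position $v$ (resp. move $e$), and $F(\mathcal S):=\prod_{e\in E}h_\sigma(e)^{\#_{\mathcal S}(e)}\cdot\prod_{t\in T}f_\sigma(t)^{\#_{\mathcal S}(t)}$. Throughout, semirings are commutative with $0\ne1$, $+$-positive and root-integral. -}

module Defs where

open import Level using (Level; _⊔_)
open import Data.Nat using (ℕ; zero; suc; _≥_) renaming (_+_ to _+ℕ_)
open import Data.Fin using (Fin; _≟_)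
open import Data.Bool using (Bool; true; false; T; if_then_else_; _∧_)
open import Data.Product using (_×_; _,_; proj₁; proj₂)
open import Data.List using (List; []; _∷_; map; foldr; filterᵇ; allFin; cartesianProduct)
open import Data.List.Relation.Unary.All using (All; []; _∷_)
open import Relation.Nullary using (¬_; does)
open import Relation.Binary.PropositionalEquality using (_≡_)
open import Relation.Binary.Construct.Closure.Transitive using (TransClosure)
open import Function.Bundles using (_⇔_)
open import Algebra.Bundles using (CommutativeSemiring)
import Algebra.Definitions.RawSemiring as RawSemiringDefs

data Player : Set where
  P0 P1 : Player

opp : Player → Player
opp P0 = P1
opp P1 = P0

-- V is the disjoint union of V₀, V₁ and T
data Kind : Set where
  owned    : Player → Kind
  terminal : Kind

isTerminal : Kind → Bool
isTerminal (owned _) = false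
isTerminal terminal  = true

-- vE, listed in increasing order (each successor exactly once)
successors : ∀ {n} → (Fin n → Fin n → Bool) → Fin n → List (Fin n)
successors {n} E v = filterᵇ (E v) (allFin n)

record GameGraph (n : ℕ) : Set where
  field
    kind : Fin n → Kind
    E    : Fin n → Fin n → Bool
    terminal-iff : ∀ v → (kind v ≡ terminal) ⇔ (successors E v ≡ [])

open GameGraph public

succ : ∀ {n} (G : GameGraph n) → Fin n → List (Fin n)
succ G = successors (E G)

moves : ∀ {n} (G : GameGraph n) → List (Fin n × Fin n)
moves {n} G = filterᵇ (λ p → E G (proj₁ p) (proj₂ p)) (cartesianProduct (allFin n) (allFin n))

terminals : ∀ {n} (G : GameGraph n) → List (Fin n)
terminals {n} G = filterᵇ (λ t → isTerminal (kind G t)) (allFin n)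

Acyclic : ∀ {n} → GameGraph n → Set
Acyclic G = ∀ v → ¬ TransClosure (λ a b → T (E G a b)) v v

-- Strategies of Player σ from v: subtrees of the tree unraveling T(G,v),
-- represented as (finite) trees whose nodes are labelled by positions.

module _ {n : ℕ} (G : GameGraph n) (σ : Player) where

  data Strat : Fin n → Set where
    leaf   : ∀ {v} → kind G v ≡ terminal → Strat v
    choose : ∀ {v} → kind G v ≡ owned σ → (w : Fin n) → T (E G v w) → Strat w → Strat v
    every  : ∀ {v} → kind G v ≡ owned (opp σ) → All Strat (succ G v) → Strat v

  private
    δ : Fin n → Fin n → ℕ
    δ a b = if does (a ≟ b) then 1 else 0

    δ₂ : Fin n → Fin n → Fin n → Fin n → ℕ
    δ₂ v w a b = if does (v ≟ a) ∧ does (w ≟ b) then 1 else 0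

  mutual
    nodeCount : ∀ {v} → Strat v → Fin n → ℕ
    nodeCount {v} (leaf _) u = δ v u
    nodeCount {v} (choose _ w _ S) u = δ v u +ℕ nodeCount S u
    nodeCount {v} (every _ Ss) u = δ v u +ℕ nodeCountAll Ss u

    nodeCountAll : ∀ {ws} → All Strat ws → Fin n → ℕ
    nodeCountAll [] u = 0
    nodeCountAll (S ∷ Ss) u = nodeCount S u +ℕ nodeCountAll Ss u

  mutual
    edgeCount : ∀ {v} → Strat v → Fin n → Fin n → ℕ
    edgeCount (leaf _) a b = 0
    edgeCount {v} (choose _ w _ S) a b = δ₂ v w a b +ℕ edgeCount S a b
    edgeCount {v} (every _ Ss) a b = edgeCountAll v Ss a b

    edgeCountAll : ∀ {ws} → Fin n → All Strat ws → Fin n → Fin n → ℕ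
    edgeCountAll v [] a b = 0
    edgeCountAll v (_∷_ {w} S Ss) a b = δ₂ v w a b +ℕ edgeCount S a b +ℕ edgeCountAll v Ss a b

module _ {c ℓ : Level} (K : CommutativeSemiring c ℓ) where
  open CommutativeSemiring K
  open RawSemiringDefs rawSemiring using (_^_)

  sumK : List Carrier → Carrier
  sumK = foldr _+_ 0#

  prodK : List Carrier → Carrier
  prodK = foldr _*_ 1#

  NonTrivial : Set ℓ
  NonTrivial = ¬ (0# ≈ 1#)

  PlusPositive : Set (c ⊔ ℓ)
  PlusPositive = ∀ a b → a + b ≈ 0# → (a ≈ 0#) × (b ≈ 0#)

  RootIntegral : Set (c ⊔ ℓ)
  RootIntegral = ∀ (x : Carrier) (k : ℕ) → k ≥ 1 → x ^ k ≈ 0# → x ≈ 0#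

  module _ {n : ℕ} (G : GameGraph n) (σ : Player) where

    -- f : V → K is the K-valuation of Player σ obtained by backward
    -- induction from the basic valuations f|T and h
    IsValuation : (h : Fin n → Fin n → Carrier) (f : Fin n → Carrier) → Set ℓ
    IsValuation h f =
      (∀ v → kind G v ≡ owned σ →
         f v ≈ sumK (map (λ w → h v w * f w) (succ G v))) ×
      (∀ v → kind G v ≡ owned (opp σ) →
         f v ≈ prodK (map (λ w → h v w * f w) (succ G v)))

    weight : (h : Fin n → Fin n → Carrier) (f : Fin n → Carrier) →
             ∀ {v} → Strat G σ v → Carrier
    weight h f S =
      prodK (map (λ e → h (proj₁ e) (proj₂ e) ^ edgeCount G σ S (proj₁ e) (proj₂ e)) (moves G)) *
      prodK (map (λ t → f t ^ nodeCount G σ S t) (terminals G))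

-- By well-founded induction along the acyclic move relation, every position v carries a
-- duplicate-free list of all strategies from v whose weights sum to f v.  From a terminal
-- position the only strategy is a leaf, of weight f v.  A strategy from a position of Player σ
-- is a move v → w followed by a strategy S from w, of weight h(vw)·F(S), so the weights sum to
-- ∑_w h(vw)·f(w).  A strategy from an opponent position is a tuple (S_w) of strategies, one for
-- each w ∈ vE, of weight ∏_w h(vw)·F(S_w), and distributivity turns the sum over all tuples
-- into ∏_w h(vw)·f(w).  Any other complete duplicate-free list of strategies is a permutation
-- of this one, so it has the same sum.
module Submission where

open import Defs
open import Level using (Level; _⊔_)
open import Data.Nat using (ℕ; zero; suc; s≤s; z≤n) renaming (_+_ to _+ℕ_)
open import Data.Nat.Properties using (n<1+n)
open import Data.Fin using (Fin; zero; suc; _≟_) renaming (_<_ to _<ᶠ_)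
open import Data.Fin.Properties using (pigeonhole)
open import Data.Bool using (T; if_then_else_; _∧_)
open import Data.Bool.Properties using (T-irrelevant)
open import Data.Product using (Σ; _×_; _,_; proj₁; proj₂; uncurry)
open import Data.Product.Properties.WithK using (,-injectiveʳ)
open import Data.Sum using (_⊎_; inj₁; inj₂)
open import Data.Empty using (⊥-elim)
open import Data.List using (List; []; _∷_; map; _++_; allFin; cartesianProductWith)
open import Data.List.Relation.Unary.All as All using (All; []; _∷_)
open import Data.List.Relation.Unary.Any using (Any; here; there)
open import Data.List.Membership.Propositional using (_∈_; find)
open import Data.List.Membership.Propositional.Properties
  using (∈-map⁺; ∈-map⁻; ∈-++⁺ˡ; ∈-++⁺ʳ; ∈-++⁻; ∈-filter⁺; ∈-filter⁻; ∈-allFin;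
         ∈-cartesianProduct⁺; ∈-cartesianProductWith⁺)
open import Data.List.Membership.Propositional.Properties.WithK using (unique∧set⇒bag)
open import Data.List.Relation.Binary.BagAndSetEquality using (_∼[_]_; set; ∼bag⇒↭)
open import Data.List.Relation.Binary.Permutation.Propositional using (_↭_; ↭⇒↭ₛ′)
import Data.List.Relation.Binary.Permutation.Propositional.Properties as Perm
open import Data.List.Relation.Binary.Permutation.Setoid.Properties using (foldr-commMonoid)
open import Data.List.Relation.Unary.Unique.Propositional using (Unique; []; _∷_)
import Data.List.Relation.Unary.Unique.Propositional.Properties as Unique
open import Relation.Nullary using (¬_; does; yes; no)
open import Relation.Nullary.Decidable.Core using (T?)
open import Relation.Binary.PropositionalEquality
  using (_≡_; _≢_; refl; sym; trans; cong; subst)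
open import Relation.Binary.PropositionalEquality.WithK using (≡-irrelevant)
open import Relation.Binary.Construct.Closure.Transitive using (TransClosure; [_]; _∷_)
open import Induction.WellFounded using (Acc; acc; WellFounded)
open import Function using (_∘_; flip)
open import Function.Bundles using (mk⇔)
open import Algebra.Bundles using (CommutativeSemiring)

private
  variable
    a b : Level
    A : Set a

all⊎any : {P Q : A → Set b} → (∀ x → P x ⊎ Q x) → ∀ xs → All P xs ⊎ Any Q xs
all⊎any P⊎Q []       = inj₁ []
all⊎any P⊎Q (x ∷ xs) with P⊎Q x | all⊎any P⊎Q xs
... | inj₂ qx | _          = inj₂ (here qx)
... | inj₁ px | inj₁ pxs   = inj₁ (px ∷ pxs)
... | inj₁ px | inj₂ anyQ  = inj₂ (there anyQ)

module _ {B : A → Set b} where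

  pairs : (xs : List A) → (∀ {x} → x ∈ xs → List (B x)) → List (Σ A B)
  pairs []       Ls = []
  pairs (x ∷ xs) Ls = map (x ,_) (Ls (here refl)) ++ pairs xs (Ls ∘ there)

  ∈-pairs⁺ : ∀ {xs} (Ls : ∀ {x} → x ∈ xs → List (B x)) {x y} (x∈xs : x ∈ xs) →
             y ∈ Ls x∈xs → (x , y) ∈ pairs xs Ls
  ∈-pairs⁺ Ls (here refl)  y∈ = ∈-++⁺ˡ (∈-map⁺ (_ ,_) y∈)
  ∈-pairs⁺ Ls (there x∈xs) y∈ = ∈-++⁺ʳ _ (∈-pairs⁺ (Ls ∘ there) x∈xs y∈)

  ∈-pairs⁻ : ∀ xs (Ls : ∀ {x} → x ∈ xs → List (B x)) {p} → p ∈ pairs xs Ls → proj₁ p ∈ xs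
  ∈-pairs⁻ (x ∷ xs) Ls p∈ with ∈-++⁻ (map (x ,_) (Ls (here refl))) p∈
  ... | inj₁ p∈ˡ with ∈-map⁻ (x ,_) p∈ˡ
  ...   | _ , _ , refl = here refl
  ∈-pairs⁻ (x ∷ xs) Ls p∈ | inj₂ p∈ʳ = there (∈-pairs⁻ xs (Ls ∘ there) p∈ʳ)

  pairs-unique : ∀ {xs} (Ls : ∀ {x} → x ∈ xs → List (B x)) →
                 Unique xs → (∀ {x} (x∈xs : x ∈ xs) → Unique (Ls x∈xs)) →
                 Unique (pairs xs Ls)
  pairs-unique {[]}     Ls []           uLs = []
  pairs-unique {x ∷ xs} Ls (x∉xs ∷ uxs) uLs =
    Unique.++⁺ (Unique.map⁺ ,-injectiveʳ (uLs (here refl)))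
               (pairs-unique (Ls ∘ there) uxs (uLs ∘ there))
               disjoint
    where
    disjoint : ∀ {p} → ¬ (p ∈ map (x ,_) (Ls (here refl)) × p ∈ pairs xs (Ls ∘ there))
    disjoint (p∈ˡ , p∈ʳ) with ∈-map⁻ (x ,_) p∈ˡ
    ... | _ , _ , refl = All.lookup x∉xs (∈-pairs⁻ xs (Ls ∘ there) p∈ʳ) refl

  tuples : (xs : List A) → (∀ {x} → x ∈ xs → List (B x)) → List (All B xs)
  tuples []       Ls = [] ∷ []
  tuples (x ∷ xs) Ls = cartesianProductWith _∷_ (Ls (here refl)) (tuples xs (Ls ∘ there))

  ∈-tuples⁺ : ∀ {xs} (Ls : ∀ {x} → x ∈ xs → List (B x)) (ys : All B xs) →
              (∀ {x} (x∈xs : x ∈ xs) → All.lookup ys x∈xs ∈ Ls x∈xs) → ys ∈ tuples xs Ls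
  ∈-tuples⁺ Ls []       ys∈ = here refl
  ∈-tuples⁺ Ls (y ∷ ys) ys∈ =
    ∈-cartesianProductWith⁺ _∷_ (ys∈ (here refl)) (∈-tuples⁺ (Ls ∘ there) ys (ys∈ ∘ there))

  tuples-unique : ∀ {xs} (Ls : ∀ {x} → x ∈ xs → List (B x)) →
                  (∀ {x} (x∈xs : x ∈ xs) → Unique (Ls x∈xs)) → Unique (tuples xs Ls)
  tuples-unique {[]}     Ls uLs = [] ∷ []
  tuples-unique {x ∷ xs} Ls uLs =
    Unique.cartesianProductWith⁺ _∷_ ∷-injective (uLs (here refl))
                                 (tuples-unique (Ls ∘ there) (uLs ∘ there))
    where
    ∷-injective : ∀ {y z : B x} {ys zs : All B xs} →
                  _≡_ {A = All B (x ∷ xs)} (y ∷ ys) (z ∷ zs) → y ≡ z × ys ≡ zs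
    ∷-injective refl = refl , refl

module ListAlgebra {c ℓ} (K : CommutativeSemiring c ℓ) where

  open CommutativeSemiring K
    renaming (refl to ≈-refl; sym to ≈-sym; trans to ≈-trans)
  open import Algebra.Properties.Semiring.Exp semiring using (_^_; ^-homo-*)
  open import Algebra.Properties.CommutativeSemigroup *-commutativeSemigroup using (interchange)
  open import Relation.Binary.Reasoning.Setoid setoid

  sumMap : (A → Carrier) → List A → Carrier
  sumMap g xs = sumK K (map g xs)

  prodMap : (A → Carrier) → List A → Carrier
  prodMap g xs = prodK K (map g xs)

  prodAll : {B : A → Set b} → (∀ {x} → B x → Carrier) → ∀ {xs} → All B xs → Carrier
  prodAll g ys = prodK K (All.reduce g ys)

  sumMap-cong : {g g′ : A → Carrier} → (∀ x → g x ≈ g′ x) → ∀ xs → sumMap g xs ≈ sumMap g′ xs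
  sumMap-cong g≈g′ []       = ≈-refl
  sumMap-cong g≈g′ (x ∷ xs) = +-cong (g≈g′ x) (sumMap-cong g≈g′ xs)

  sumMap-++ : (g : A → Carrier) (xs ys : List A) → sumMap g (xs ++ ys) ≈ sumMap g xs + sumMap g ys
  sumMap-++ g []       ys = ≈-sym (+-identityˡ _)
  sumMap-++ g (x ∷ xs) ys = ≈-trans (+-congˡ (sumMap-++ g xs ys)) (≈-sym (+-assoc _ _ _))

  sumMap-map : ∀ {B : Set b} (g : B → Carrier) (k : A → B) (xs : List A) →
               sumMap g (map k xs) ≡ sumMap (g ∘ k) xs
  sumMap-map g k []       = refl
  sumMap-map g k (x ∷ xs) = cong (g (k x) +_) (sumMap-map g k xs)

  *-distribˡ-sumMap : (u : Carrier) (g : A → Carrier) (xs : List A) →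
                      u * sumMap g xs ≈ sumMap (λ x → u * g x) xs
  *-distribˡ-sumMap u g []       = zeroʳ u
  *-distribˡ-sumMap u g (x ∷ xs) = ≈-trans (distribˡ u _ _) (+-congˡ (*-distribˡ-sumMap u g xs))

  sumMap-↭ : (g : A → Carrier) {xs ys : List A} → xs ↭ ys → sumMap g xs ≈ sumMap g ys
  sumMap-↭ g xs↭ys =
    foldr-commMonoid setoid +-isCommutativeMonoid (↭⇒↭ₛ′ isEquivalence (Perm.map⁺ g xs↭ys))

  sumMap-unique∧set : (g : A → Carrier) {xs ys : List A} → Unique xs → Unique ys → xs ∼[ set ] ys →
                      sumMap g xs ≈ sumMap g ys
  sumMap-unique∧set g uxs uys xs∼ys = sumMap-↭ g (∼bag⇒↭ (unique∧set⇒bag uxs uys xs∼ys))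

  sumMap-cartesianProductWith :
    ∀ {B : Set b} {C : Set a} (f : A → B → C) →
    (g : C → Carrier) (g₁ : A → Carrier) (g₂ : B → Carrier) →
    (∀ x y → g (f x y) ≈ g₁ x * g₂ y) →
    ∀ xs ys → sumMap g (cartesianProductWith f xs ys) ≈ sumMap g₁ xs * sumMap g₂ ys
  sumMap-cartesianProductWith f g g₁ g₂ g∘f≈ []       ys = ≈-sym (zeroˡ _)
  sumMap-cartesianProductWith f g g₁ g₂ g∘f≈ (x ∷ xs) ys = begin
    sumMap g (map (f x) ys ++ cartesianProductWith f xs ys)
      ≈⟨ sumMap-++ g (map (f x) ys) _ ⟩
    sumMap g (map (f x) ys) + sumMap g (cartesianProductWith f xs ys)
      ≈⟨ +-cong (reflexive (sumMap-map g (f x) ys)) (sumMap-cartesianProductWith f g g₁ g₂ g∘f≈ xs ys) ⟩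
    sumMap (g ∘ f x) ys + sumMap g₁ xs * sumMap g₂ ys
      ≈⟨ +-congʳ (≈-trans (sumMap-cong (g∘f≈ x) ys) (≈-sym (*-distribˡ-sumMap (g₁ x) g₂ ys))) ⟩
    g₁ x * sumMap g₂ ys + sumMap g₁ xs * sumMap g₂ ys
      ≈⟨ distribʳ _ _ _ ⟨
    sumMap g₁ (x ∷ xs) * sumMap g₂ ys ∎

  module _ {B : A → Set b} where

    sumMap-pairs : ∀ {xs} (Ls : ∀ {x} → x ∈ xs → List (B x)) (g : Σ A B → Carrier) (k : A → Carrier) →
                   (∀ {x} (x∈xs : x ∈ xs) → sumMap (g ∘ (x ,_)) (Ls x∈xs) ≈ k x) →
                   sumMap g (pairs xs Ls) ≈ sumMap k xs
    sumMap-pairs {[]}     Ls g k sums = ≈-refl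
    sumMap-pairs {x ∷ xs} Ls g k sums = begin
      sumMap g (map (x ,_) (Ls (here refl)) ++ pairs xs (Ls ∘ there))
        ≈⟨ sumMap-++ g (map (x ,_) (Ls (here refl))) _ ⟩
      sumMap g (map (x ,_) (Ls (here refl))) + sumMap g (pairs xs (Ls ∘ there))
        ≈⟨ +-cong (≈-trans (reflexive (sumMap-map g (x ,_) (Ls (here refl)))) (sums (here refl)))
                  (sumMap-pairs (Ls ∘ there) g k (sums ∘ there)) ⟩
      k x + sumMap k xs ∎

    sumMap-tuples : ∀ {xs} (Ls : ∀ {x} → x ∈ xs → List (B x)) →
                    (g : ∀ {x} → B x → Carrier) (k : A → Carrier) →
                    (∀ {x} (x∈xs : x ∈ xs) → sumMap g (Ls x∈xs) ≈ k x) →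
                    sumMap (prodAll g) (tuples xs Ls) ≈ prodMap k xs
    sumMap-tuples {[]}     Ls g k sums = +-identityʳ 1#
    sumMap-tuples {x ∷ xs} Ls g k sums = ≈-trans
      (sumMap-cartesianProductWith _∷_ (prodAll g) g (prodAll g) (λ _ _ → ≈-refl)
                                   (Ls (here refl)) (tuples xs (Ls ∘ there)))
      (*-cong (sums (here refl)) (sumMap-tuples (Ls ∘ there) g k (sums ∘ there)))

  powProd : List A → (A → Carrier) → (A → ℕ) → Carrier
  powProd xs g k = prodMap (λ x → g x ^ k x) xs

  powProd-zero : ∀ xs (g : A → Carrier) {k : A → ℕ} →
                 (∀ {x} → x ∈ xs → k x ≡ 0) → powProd xs g k ≈ 1#
  powProd-zero []       g k≡0 = ≈-refl
  powProd-zero (x ∷ xs) g k≡0 rewrite k≡0 (here refl) =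
    ≈-trans (*-identityˡ _) (powProd-zero xs g (k≡0 ∘ there))

  powProd-+ : ∀ xs (g : A → Carrier) (k₁ k₂ : A → ℕ) →
              powProd xs g (λ x → k₁ x +ℕ k₂ x) ≈ powProd xs g k₁ * powProd xs g k₂
  powProd-+ []       g k₁ k₂ = ≈-sym (*-identityˡ 1#)
  powProd-+ (x ∷ xs) g k₁ k₂ = begin
    g x ^ (k₁ x +ℕ k₂ x) * powProd xs g (λ x → k₁ x +ℕ k₂ x)
      ≈⟨ *-cong (^-homo-* (g x) (k₁ x) (k₂ x)) (powProd-+ xs g k₁ k₂) ⟩
    (g x ^ k₁ x * g x ^ k₂ x) * (powProd xs g k₁ * powProd xs g k₂)
      ≈⟨ interchange _ _ _ _ ⟩
    (g x ^ k₁ x * powProd xs g k₁) * (g x ^ k₂ x * powProd xs g k₂) ∎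

  powProd-indicator : ∀ {xs} (g : A → Carrier) {k : A → ℕ} {x₀} → Unique xs → x₀ ∈ xs →
                      k x₀ ≡ 1 → (∀ {x} → x ∈ xs → x ≢ x₀ → k x ≡ 0) → powProd xs g k ≈ g x₀
  powProd-indicator {xs = x ∷ xs} g (x∉xs ∷ _) (here refl) k≡1 k≡0 rewrite k≡1 =
    ≈-trans (*-cong (*-identityʳ (g x))
                    (powProd-zero xs g (λ y∈ → k≡0 (there y∈) (All.lookup x∉xs y∈ ∘ sym))))
            (*-identityʳ (g x))
  powProd-indicator {xs = x ∷ xs} g (x∉xs ∷ uxs) (there x₀∈) k≡1 k≡0
    rewrite k≡0 (here refl) (All.lookup x∉xs x₀∈) =
    ≈-trans (*-identityˡ _) (powProd-indicator g uxs x₀∈ k≡1 (k≡0 ∘ there))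

owned≢owned-opp : ∀ σ → owned σ ≢ owned (opp σ)
owned≢owned-opp P0 ()
owned≢owned-opp P1 ()

player≡⊎opp : ∀ p σ → p ≡ σ ⊎ p ≡ opp σ
player≡⊎opp P0 P0 = inj₁ refl
player≡⊎opp P0 P1 = inj₂ refl
player≡⊎opp P1 P0 = inj₂ refl
player≡⊎opp P1 P1 = inj₁ refl

module GameGraphProperties {n : ℕ} (G : GameGraph n) where

  _⟶_ : Fin n → Fin n → Set
  v ⟶ w = T (E G v w)

  ∈-succ⁻ : ∀ {v w} → w ∈ succ G v → v ⟶ w
  ∈-succ⁻ {v} w∈ = proj₂ (∈-filter⁻ (T? ∘ E G v) {xs = allFin n} w∈)

  ∈-succ⁺ : ∀ {v w} → v ⟶ w → w ∈ succ G v
  ∈-succ⁺ {v} {w} v⟶w = ∈-filter⁺ (T? ∘ E G v) (∈-allFin w) v⟶w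

  succ-unique : ∀ v → Unique (succ G v)
  succ-unique v = Unique.filter⁺ (T? ∘ E G v) (Unique.allFin⁺ n)

  moves-unique : Unique (moves G)
  moves-unique = Unique.filter⁺ (λ e → T? (uncurry (E G) e))
                                (Unique.cartesianProduct⁺ (Unique.allFin⁺ n) (Unique.allFin⁺ n))

  ∈-moves⁺ : ∀ {v w} → v ⟶ w → (v , w) ∈ moves G
  ∈-moves⁺ {v} {w} =
    ∈-filter⁺ (λ e → T? (uncurry (E G) e)) (∈-cartesianProduct⁺ (∈-allFin v) (∈-allFin w))

  terminals-unique : Unique (terminals G)
  terminals-unique = Unique.filter⁺ (λ t → T? (isTerminal (kind G t))) (Unique.allFin⁺ n)

  ∈-terminals⁺ : ∀ {v} → kind G v ≡ terminal → v ∈ terminals G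
  ∈-terminals⁺ {v} v-terminal =
    ∈-filter⁺ (λ t → T? (isTerminal (kind G t))) (∈-allFin v) (subst (T ∘ isTerminal) (sym v-terminal) _)

  ∈-terminals⁻ : ∀ {t} → t ∈ terminals G → T (isTerminal (kind G t))
  ∈-terminals⁻ = proj₂ ∘ ∈-filter⁻ (λ t → T? (isTerminal (kind G t))) {xs = allFin n}

  data Walk : ℕ → Fin n → Set where
    []  : ∀ {v} → Walk zero v
    _∷_ : ∀ {k v w} → v ⟶ w → Walk k w → Walk (suc k) v

  visit : ∀ {k v} → Walk k v → Fin (suc k) → Fin n
  visit {v = v} p       zero    = v
  visit         (_ ∷ p) (suc i) = visit p i

  visit-path : ∀ {k v} (p : Walk k v) {i j} → i <ᶠ j → TransClosure _⟶_ (visit p i) (visit p j)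
  visit-path (e ∷ p)      {zero}  {suc zero}    _         = [ e ]
  visit-path (e ∷ e′ ∷ p) {zero}  {suc (suc j)} _         = e ∷ visit-path (e′ ∷ p) {j = suc j} (s≤s z≤n)
  visit-path (e ∷ p)      {suc i} {suc j}       (s≤s i<j) = visit-path p i<j

  accessible⊎walk : ∀ k v → Acc (flip _⟶_) v ⊎ Walk k v
  accessible⊎walk zero    v = inj₂ []
  accessible⊎walk (suc k) v with all⊎any (accessible⊎walk k) (succ G v)
  ... | inj₁ accs = inj₁ (acc (λ v⟶w → All.lookup accs (∈-succ⁺ v⟶w)))
  ... | inj₂ walks with find walks
  ...   | w , w∈ , p = inj₂ (∈-succ⁻ w∈ ∷ p)

  -- A walk with n moves visits n + 1 positions, so by pigeonhole it runs through a cycle.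
  acyclic⇒wellFounded : Acyclic G → WellFounded (flip _⟶_)
  acyclic⇒wellFounded acyclic v with accessible⊎walk n v
  ... | inj₁ accessible = accessible
  ... | inj₂ p with pigeonhole (n<1+n n) (visit p)
  ...   | i , j , i<j , same =
    ⊥-elim (acyclic (visit p i) (subst (TransClosure _⟶_ (visit p i)) (sym same) (visit-path p i<j)))

  module Strategies (σ : Player) where

    data Turn (v : Fin n) : Set where
      game-over     : kind G v ≡ terminal → Turn v
      own-turn      : kind G v ≡ owned σ → Turn v
      opponent-turn : kind G v ≡ owned (opp σ) → Turn v

    turn : ∀ v → Turn v
    turn v with kind G v in kind≡
    ... | terminal = game-over kind≡
    ... | owned p with player≡⊎opp p σ
    ...   | inj₁ refl = own-turn kind≡
    ...   | inj₂ refl = opponent-turn kind≡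

    leaf-unique : ∀ {v} (p : kind G v ≡ terminal) (S : Strat G σ v) → S ≡ leaf p
    leaf-unique p (leaf q)         rewrite ≡-irrelevant q p = refl
    leaf-unique p (choose q _ _ _) with () ← trans (sym p) q
    leaf-unique p (every q _)      with () ← trans (sym p) q

    choose-inverse : ∀ {v} (p : kind G v ≡ owned σ) (S : Strat G σ v) →
                     Σ (Fin n) λ w → Σ (v ⟶ w) λ e → Σ (Strat G σ w) λ S′ → S ≡ choose p w e S′
    choose-inverse p (leaf q)          with () ← trans (sym q) p
    choose-inverse p (choose q w e S′) rewrite ≡-irrelevant q p = w , e , S′ , refl
    choose-inverse p (every q _)       = ⊥-elim (owned≢owned-opp σ (trans (sym p) q))

    every-inverse : ∀ {v} (p : kind G v ≡ owned (opp σ)) (S : Strat G σ v) →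
                    Σ (All (Strat G σ) (succ G v)) λ Ss → S ≡ every p Ss
    every-inverse p (leaf q)         with () ← trans (sym q) p
    every-inverse p (choose q _ _ _) = ⊥-elim (owned≢owned-opp σ (trans (sym q) p))
    every-inverse p (every q Ss)     rewrite ≡-irrelevant q p = Ss , refl

module Weights {c ℓ} (K : CommutativeSemiring c ℓ) {n : ℕ} (G : GameGraph n) (σ : Player)
               (h : Fin n → Fin n → CommutativeSemiring.Carrier K)
               (f : Fin n → CommutativeSemiring.Carrier K) where

  open CommutativeSemiring K
    renaming (refl to ≈-refl; sym to ≈-sym; trans to ≈-trans)
  open ListAlgebra K
  open GameGraphProperties G
  open import Algebra.Properties.CommutativeSemigroup *-commutativeSemigroup using (interchange)
  open import Relation.Binary.Reasoning.Setoid setoid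

  F : ∀ {v} → Strat G σ v → Carrier
  F = weight K G σ h f

  -- Definitionally equal to the private indicators with which Defs counts nodes and edges.
  nodeIndicator : Fin n → Fin n → ℕ
  nodeIndicator v u = if does (v ≟ u) then 1 else 0

  edgeIndicator : Fin n → Fin n → Fin n → Fin n → ℕ
  edgeIndicator v w a b = if does (v ≟ a) ∧ does (w ≟ b) then 1 else 0

  -- F S is countWeight (edgeCount G σ S) (nodeCount G σ S) by definition, and countWeight turns
  -- pointwise sums of counts into products (countWeight-+), so F is multiplicative over subtrees.
  countWeight : (Fin n → Fin n → ℕ) → (Fin n → ℕ) → Carrier
  countWeight ε ν = powProd (moves G) (uncurry h) (uncurry ε) * powProd (terminals G) f ν

  nodeIndicator-self : ∀ v → nodeIndicator v v ≡ 1
  nodeIndicator-self v with v ≟ v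
  ... | yes _  = refl
  ... | no v≢v = ⊥-elim (v≢v refl)

  nodeIndicator-other : ∀ {v u} → u ≢ v → nodeIndicator v u ≡ 0
  nodeIndicator-other {v} {u} u≢v with v ≟ u
  ... | yes refl = ⊥-elim (u≢v refl)
  ... | no _     = refl

  edgeIndicator-self : ∀ v w → edgeIndicator v w v w ≡ 1
  edgeIndicator-self v w with v ≟ v | w ≟ w
  ... | yes _ | yes _  = refl
  ... | no v≢v | _     = ⊥-elim (v≢v refl)
  ... | yes _ | no w≢w = ⊥-elim (w≢w refl)

  edgeIndicator-other : ∀ {v w} a b → (a , b) ≢ (v , w) → edgeIndicator v w a b ≡ 0
  edgeIndicator-other {v} {w} a b ab≢vw with v ≟ a | w ≟ b
  ... | yes refl | yes refl = ⊥-elim (ab≢vw refl)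
  ... | no _     | _        = refl
  ... | yes _    | no _     = refl

  powProd-edgeIndicator : ∀ {v w} → v ⟶ w →
                          powProd (moves G) (uncurry h) (uncurry (edgeIndicator v w)) ≈ h v w
  powProd-edgeIndicator {v} {w} v⟶w =
    powProd-indicator (uncurry h) moves-unique (∈-moves⁺ v⟶w) (edgeIndicator-self v w)
                      (λ {(a , b)} _ → edgeIndicator-other a b)

  powProd-nodeIndicator-terminal : ∀ {v} → kind G v ≡ terminal →
                                   powProd (terminals G) f (nodeIndicator v) ≈ f v
  powProd-nodeIndicator-terminal {v} v-terminal =
    powProd-indicator f terminals-unique (∈-terminals⁺ v-terminal) (nodeIndicator-self v)
                      (λ _ → nodeIndicator-other)

  powProd-nodeIndicator-owned : ∀ {v p} → kind G v ≡ owned p → powProd (terminals G) f (nodeIndicator v) ≈ 1#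
  powProd-nodeIndicator-owned {v} v-owned =
    powProd-zero (terminals G) f {nodeIndicator v} λ {t} t∈ → nodeIndicator-other {v} {t} λ where
      refl → subst (T ∘ isTerminal) v-owned (∈-terminals⁻ t∈)

  countWeight-+ : ∀ ε₁ ν₁ ε₂ ν₂ →
                  countWeight (λ a b → ε₁ a b +ℕ ε₂ a b) (λ u → ν₁ u +ℕ ν₂ u) ≈
                  countWeight ε₁ ν₁ * countWeight ε₂ ν₂
  countWeight-+ ε₁ ν₁ ε₂ ν₂ = ≈-trans
    (*-cong (powProd-+ (moves G) (uncurry h) (uncurry ε₁) (uncurry ε₂)) (powProd-+ (terminals G) f ν₁ ν₂))
    (interchange _ _ _ _)

  countWeight-inner-node : ∀ {v p} → kind G v ≡ owned p →
                           ∀ ε ν → countWeight ε (λ u → nodeIndicator v u +ℕ ν u) ≈ countWeight ε ν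
  countWeight-inner-node {v} v-owned ε ν = begin
    countWeight (λ a b → 0 +ℕ ε a b) (λ u → nodeIndicator v u +ℕ ν u)
      ≈⟨ countWeight-+ (λ _ _ → 0) (nodeIndicator v) ε ν ⟩
    countWeight (λ _ _ → 0) (nodeIndicator v) * countWeight ε ν
      ≈⟨ *-congʳ (*-cong (powProd-zero (moves G) (uncurry h) (λ _ → refl))
                         (powProd-nodeIndicator-owned v-owned)) ⟩
    (1# * 1#) * countWeight ε ν
      ≈⟨ *-congʳ (*-identityˡ 1#) ⟩
    1# * countWeight ε ν
      ≈⟨ *-identityˡ _ ⟩
    countWeight ε ν ∎

  countWeight-move : ∀ {v w} → v ⟶ w → (S : Strat G σ w) →
                     countWeight (λ a b → edgeIndicator v w a b +ℕ edgeCount G σ S a b) (nodeCount G σ S) ≈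
                     h v w * F S
  countWeight-move {v} {w} v⟶w S = begin
    countWeight (λ a b → edgeIndicator v w a b +ℕ edgeCount G σ S a b) (λ u → 0 +ℕ nodeCount G σ S u)
      ≈⟨ countWeight-+ (edgeIndicator v w) (λ _ → 0) (edgeCount G σ S) (nodeCount G σ S) ⟩
    countWeight (edgeIndicator v w) (λ _ → 0) * F S
      ≈⟨ *-congʳ (*-cong (powProd-edgeIndicator v⟶w) (powProd-zero (terminals G) f (λ _ → refl))) ⟩
    (h v w * 1#) * F S
      ≈⟨ *-congʳ (*-identityʳ (h v w)) ⟩
    h v w * F S ∎

  F-leaf : ∀ {v} (v-terminal : kind G v ≡ terminal) → F (leaf v-terminal) ≈ f v
  F-leaf v-terminal = ≈-trans
    (*-cong (powProd-zero (moves G) (uncurry h) (λ _ → refl)) (powProd-nodeIndicator-terminal v-terminal))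
    (*-identityˡ _)

  F-choose : ∀ {v w} (v-own : kind G v ≡ owned σ) (v⟶w : v ⟶ w) (S : Strat G σ w) →
             F (choose v-own w v⟶w S) ≈ h v w * F S
  F-choose {v} {w} v-own v⟶w S = ≈-trans
    (countWeight-inner-node v-own (λ a b → edgeIndicator v w a b +ℕ edgeCount G σ S a b) (nodeCount G σ S))
    (countWeight-move v⟶w S)

  countWeight-children : ∀ {v xs} → (∀ {w} → w ∈ xs → v ⟶ w) → (Ss : All (Strat G σ) xs) →
                         countWeight (edgeCountAll G σ v Ss) (nodeCountAll G σ Ss) ≈
                         prodAll (λ {w} S → h v w * F S) Ss
  countWeight-children children [] =
    ≈-trans (*-cong (powProd-zero (moves G) (uncurry h) (λ _ → refl))
                    (powProd-zero (terminals G) f (λ _ → refl)))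
            (*-identityˡ 1#)
  countWeight-children {v} children (_∷_ {w} S Ss) = ≈-trans
    (countWeight-+ (λ a b → edgeIndicator v w a b +ℕ edgeCount G σ S a b) (nodeCount G σ S)
                   (edgeCountAll G σ v Ss) (nodeCountAll G σ Ss))
    (*-cong (countWeight-move (children (here refl)) S) (countWeight-children (children ∘ there) Ss))

  F-every : ∀ {v} (v-opponent : kind G v ≡ owned (opp σ)) (Ss : All (Strat G σ) (succ G v)) →
            F (every v-opponent Ss) ≈ prodAll (λ {w} S → h v w * F S) Ss
  F-every {v} v-opponent Ss = ≈-trans
    (countWeight-inner-node v-opponent (edgeCountAll G σ v Ss) (nodeCountAll G σ Ss))
    (countWeight-children ∈-succ⁻ Ss)

module Enumerations {c ℓ} (K : CommutativeSemiring c ℓ) {n : ℕ} (G : GameGraph n) (σ : Player)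
                    (h : Fin n → Fin n → CommutativeSemiring.Carrier K)
                    (f : Fin n → CommutativeSemiring.Carrier K)
                    (f-valuation : IsValuation K G σ h f) where

  open CommutativeSemiring K
    renaming (refl to ≈-refl; sym to ≈-sym; trans to ≈-trans)
  open ListAlgebra K
  open GameGraphProperties G
  open Strategies σ
  open Weights K G σ h f
  open import Relation.Binary.Reasoning.Setoid setoid

  record Enumeration (v : Fin n) : Set (c ⊔ ℓ) where
    field
      strategies : List (Strat G σ v)
      complete   : ∀ S → S ∈ strategies
      unique     : Unique strategies
      f≈sum      : f v ≈ sumMap F strategies
  open Enumeration

  sumMap-scaled-F : ∀ {w} (u : Carrier) (En : Enumeration w) → sumMap (λ S → u * F S) (strategies En) ≈ u * f w
  sumMap-scaled-F u En = ≈-sym (≈-trans (*-congˡ (f≈sum En)) (*-distribˡ-sumMap u F (strategies En)))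

  enumeration-terminal : ∀ {v} → kind G v ≡ terminal → Enumeration v
  enumeration-terminal v-terminal = record
    { strategies = leaf v-terminal ∷ []
    ; complete   = λ S → here (leaf-unique v-terminal S)
    ; unique     = [] ∷ []
    ; f≈sum      = ≈-sym (≈-trans (+-identityʳ _) (F-leaf v-terminal))
    }

  module _ {v} (children : ∀ {w} → w ∈ succ G v → Enumeration w) where

    enumeration-own : kind G v ≡ owned σ → Enumeration v
    enumeration-own v-own = record
      { strategies = map chosen candidates
      ; complete   = complete′
      ; unique     = Unique.map⁺ chosen-injective
                       (pairs-unique moveStrategies (succ-unique v)
                                     (Unique.map⁺ ,-injectiveʳ ∘ unique ∘ children))
      ; f≈sum      = f≈sum′
      }
      where
      Move : Fin n → Set
      Move w = v ⟶ w × Strat G σ w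

      chosen : Σ (Fin n) Move → Strat G σ v
      chosen (w , v⟶w , S) = choose v-own w v⟶w S

      chosen-injective : ∀ {m m′} → chosen m ≡ chosen m′ → m ≡ m′
      chosen-injective refl = refl

      moveStrategies : ∀ {w} → w ∈ succ G v → List (Move w)
      moveStrategies w∈ = map (∈-succ⁻ w∈ ,_) (strategies (children w∈))

      candidates : List (Σ (Fin n) Move)
      candidates = pairs (succ G v) moveStrategies

      complete′ : ∀ S → S ∈ map chosen candidates
      complete′ S with choose-inverse v-own S
      ... | w , v⟶w , S′ , refl = ∈-map⁺ chosen (∈-pairs⁺ moveStrategies (∈-succ⁺ v⟶w) move∈)
        where
        move∈ : (v⟶w , S′) ∈ moveStrategies (∈-succ⁺ v⟶w)
        move∈ = subst (λ e → (e , S′) ∈ moveStrategies (∈-succ⁺ v⟶w)) (T-irrelevant _ v⟶w)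
                      (∈-map⁺ (_ ,_) (complete (children _) S′))

      sum-move : ∀ {w} (w∈ : w ∈ succ G v) →
                 sumMap (F ∘ chosen ∘ (w ,_)) (moveStrategies w∈) ≈ h v w * f w
      sum-move {w} w∈ = begin
        sumMap (F ∘ chosen ∘ (w ,_)) (moveStrategies w∈)
          ≡⟨ sumMap-map (F ∘ chosen ∘ (w ,_)) (∈-succ⁻ w∈ ,_) (strategies (children w∈)) ⟩
        sumMap (λ S → F (choose v-own w (∈-succ⁻ w∈) S)) (strategies (children w∈))
          ≈⟨ sumMap-cong (F-choose v-own (∈-succ⁻ w∈)) (strategies (children w∈)) ⟩
        sumMap (λ S → h v w * F S) (strategies (children w∈))
          ≈⟨ sumMap-scaled-F (h v w) (children w∈) ⟩
        h v w * f w ∎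

      f≈sum′ : f v ≈ sumMap F (map chosen candidates)
      f≈sum′ = begin
        f v                                     ≈⟨ proj₁ f-valuation v v-own ⟩
        sumMap (λ w → h v w * f w) (succ G v)   ≈⟨ sumMap-pairs moveStrategies (F ∘ chosen) _ sum-move ⟨
        sumMap (F ∘ chosen) candidates          ≡⟨ sumMap-map F chosen candidates ⟨
        sumMap F (map chosen candidates)        ∎

    enumeration-opponent : kind G v ≡ owned (opp σ) → Enumeration v
    enumeration-opponent v-opponent = record
      { strategies = map (every v-opponent) candidates
      ; complete   = complete′
      ; unique     = Unique.map⁺ every-injective (tuples-unique childStrategies (unique ∘ children))
      ; f≈sum      = f≈sum′
      }
      where
      childStrategies : ∀ {w} → w ∈ succ G v → List (Strat G σ w)
      childStrategies = strategies ∘ children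

      candidates : List (All (Strat G σ) (succ G v))
      candidates = tuples (succ G v) childStrategies

      every-injective : ∀ {Ss Ss′} → every v-opponent Ss ≡ every v-opponent Ss′ → Ss ≡ Ss′
      every-injective refl = refl

      complete′ : ∀ S → S ∈ map (every v-opponent) candidates
      complete′ S with every-inverse v-opponent S
      ... | Ss , refl = ∈-map⁺ (every v-opponent)
                          (∈-tuples⁺ childStrategies Ss (λ w∈ → complete (children w∈) (All.lookup Ss w∈)))

      f≈sum′ : f v ≈ sumMap F (map (every v-opponent) candidates)
      f≈sum′ = begin
        f v
          ≈⟨ proj₂ f-valuation v v-opponent ⟩
        prodMap (λ w → h v w * f w) (succ G v)
          ≈⟨ sumMap-tuples childStrategies (λ {w} S → h v w * F S) _
                           (λ {w} w∈ → sumMap-scaled-F (h v w) (children w∈)) ⟨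
        sumMap (prodAll (λ {w} S → h v w * F S)) candidates
          ≈⟨ sumMap-cong (≈-sym ∘ F-every v-opponent) candidates ⟩
        sumMap (F ∘ every v-opponent) candidates
          ≡⟨ sumMap-map F (every v-opponent) candidates ⟨
        sumMap F (map (every v-opponent) candidates) ∎

  enumerate : ∀ v → Acc (flip _⟶_) v → Enumeration v
  enumerate v (acc rs) with turn v
  ... | game-over     v-terminal = enumeration-terminal v-terminal
  ... | own-turn      v-own      = enumeration-own (λ w∈ → enumerate _ (rs (∈-succ⁻ w∈))) v-own
  ... | opponent-turn v-opponent = enumeration-opponent (λ w∈ → enumerate _ (rs (∈-succ⁻ w∈))) v-opponent

  f≈sumMap-F : Acyclic G → ∀ v (L : List (Strat G σ v)) →
               (∀ S → S ∈ L) → Unique L → f v ≈ sumMap F L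
  f≈sumMap-F acyclic v L L-complete L-unique =
    ≈-trans (f≈sum En) (sumMap-unique∧set F (unique En) L-unique (mk⇔ (λ _ → L-complete _) (λ _ → complete En _)))
    where
    En : Enumeration v
    En = enumerate v (acyclic⇒wellFounded acyclic v)

mainTheorem2 : ∀ {c ℓ : Level} (K : CommutativeSemiring c ℓ) →
    NonTrivial K → PlusPositive K → RootIntegral K →
    ∀ {n : ℕ} (G : GameGraph n) → Acyclic G →
    (σ : Player) →
    (h : Fin n → Fin n → CommutativeSemiring.Carrier K) →
    (∀ a b → T (E G a b) → ¬ CommutativeSemiring._≈_ K (h a b) (CommutativeSemiring.0# K)) →
    (f : Fin n → CommutativeSemiring.Carrier K) →
    IsValuation K G σ h f →
    (v : Fin n) →
    (L : List (Strat G σ v)) → (∀ S → S ∈ L) → Unique L →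
    CommutativeSemiring._≈_ K (f v) (sumK K (map (weight K G σ h f) L))
mainTheorem2 K _ _ _ G acyclic σ h _ f f-valuation =
  Enumerations.f≈sumMap-F K G σ h f f-valuation acyclic
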